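{- For all integers $n\ge 1$ and $k,\ell\ge 0$, \[\sum_{j=1}^{n}\binom{n}{j}\frac{(-1)^{j-1}}{j^k}\,\zeta^{\ast}_j(\{1\}_{\ell})=\begin{cases}\zeta^{\ast}_n(\{1\}_{k-1},\ell+1), & k\ge 1,\\[1mm] \dfrac{1}{n^{\ell}}, & k=0.\end{cases}\]
   Context: $\zeta^{\ast}_N(i_1,\dots,i_k)=\sum_{N\ge n_1\ge\cdots\ge n_k\ge 1}\frac{1}{n_1^{i_1}\cdots n_k^{i_k}}$ for positive integers $i_1,\dots,i_k$ (truncated multiple zeta star value); $\{1\}_m$ denotes $1$ repeated $m$ times, with the convention $\zeta^{\ast}_n(\{1\}_0)=1$. -}

module Defs where

open import Data.Nat as ℕ using (ℕ; zero; suc)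
open import Data.Nat.Properties using (m^n≢0)
open import Data.Nat.Combinatorics using (_C_)
open import Data.Integer as ℤ using (ℤ; +_)
open import Data.Rational using (ℚ; 0ℚ; 1ℚ; _+_; _*_; -_; _/_)
open import Data.List using (List; []; _∷_; replicate; _++_)

sum1 : ℕ → (ℕ → ℚ) → ℚ
sum1 zero    f = 0ℚ
sum1 (suc N) f = sum1 N f + f (suc N)

inv-pow : (m : ℕ) → ℕ → ℚ
inv-pow m i = (+ 1) / (suc m ℕ.^ i)
  where instance
    nz : ℕ.NonZero (suc m ℕ.^ i)
    nz = m^n≢0 (suc m) i

-- truncated multiple zeta star value
-- ζ*_N(i₁,…,i_k) = Σ_{N ≥ n₁ ≥ … ≥ n_k ≥ 1} 1/(n₁^{i₁}⋯n_k^{i_k}),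
-- computed recursively: ζ*_N() = 1,
-- ζ*_N(i₁,i₂,…) = Σ_{n₁=1}^{N} n₁^{-i₁} ζ*_{n₁}(i₂,…).
zetaStar : ℕ → List ℕ → ℚ
zetaStar N []       = 1ℚ
zetaStar N (i ∷ is) = go N
  where
  go : ℕ → ℚ
  go zero    = 0ℚ
  go (suc m) = go m + inv-pow m i * zetaStar (suc m) is

sign : ℕ → ℚ
sign zero    = 1ℚ
sign (suc e) = - sign e

ones : ℕ → List ℕ
ones m = replicate m 1

lhs : ℕ → ℕ → ℕ → ℚ
lhs n k ℓ = sum1 n (λ j → ((+ (n C j)) / 1) * sign (j ℕ.∸ 1) * jinv j * zetaStar j (ones ℓ))
  where
  jinv : ℕ → ℚ
  jinv zero    = 0ℚ   -- never used: j ranges over 1..n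
  jinv (suc m) = inv-pow m k

module Submission where

-- Write 𝔅 n a = Σ_{j=1}^{n} C(n,j) (-1)^{j-1} a_j for the (signed) binomial
-- transform of a sequence a, and a/j^k for the sequence j ↦ a_j / j^k.
-- The left-hand side of the theorem is 𝔅 n (ζ★({1}_ℓ)/j^k).
--
-- Three elementary identities drive everything.  Pascal's rule gives
-- 𝔅 (n+1) a = 𝔅 n a + 𝔅′ n a, where 𝔅′ uses the coefficients C(n,j-1);
-- re-indexing gives 𝔅′ n a = a_1 - 𝔅 n (a ∘ suc); and the absorption
-- identity j·C(n+1,j) = (n+1)·C(n,j-1) gives 𝔅′ n a = 𝔅 (n+1) (j·a_j) / (n+1).
-- From these:
--   * k ≥ 1: n ↦ 𝔅 n (a/j^{k+1}) satisfies the same first-order recurrence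
--     in n as ζ★_n(1, …), namely increments 𝔅 (n+1) (a/j^k) / (n+1); so the
--     case k ≥ 1 follows from the case k = 0 by induction on k;
--   * k = 0: a summation-by-parts formula for 𝔅 reduces ζ★({1}_{ℓ+1}) to the
--     depth-one value ζ★(ℓ+1), itself obtained from the case k = 0 for ℓ;
--     so the case k = 0 follows by induction on ℓ.

open import Data.Nat as ℕ using (ℕ; zero; suc; _≥_; _∸_)
import Data.Nat.Properties as ℕP
import Data.Nat.Tactic.RingSolver as ℕ-Ring
open import Data.Nat.Combinatorics using (_C_; nC1≡n; k>n⇒nCk≡0; nCk+nC[k+1]≡[n+1]C[k+1])
import Data.Integer as ℤ
open import Data.Integer using (+_)
import Data.Integer.Properties as ℤP
open import Data.Rational using (ℚ; 0ℚ; 1ℚ; _+_; _*_; -_; _-_; _/_; toℚᵘ)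
open import Data.Rational.Properties
  using ( toℚᵘ-injective; toℚᵘ-fromℚᵘ; toℚᵘ-homo-+; toℚᵘ-homo-*; _≟_; +-*-commutativeRing
        ; +-assoc; +-comm; *-assoc; *-comm; *-identityˡ; *-identityʳ; *-zeroʳ
        ; *-distribˡ-+; neg-distrib-+ )
import Data.Rational.Unnormalised as ℚᵘ
import Data.Rational.Unnormalised.Properties as ℚᵘP
open import Data.List using ([]; _∷_; _++_)
open import Data.Product using (_×_; _,_)
open import Relation.Binary.PropositionalEquality
open import Relation.Nullary.Decidable using (dec⇒maybe)
open import Tactic.RingSolver using (solve-∀)
open import Tactic.RingSolver.Core.AlmostCommutativeRing using (AlmostCommutativeRing; fromCommutativeRing)
open import Level using (0ℓ)
open import Defs

open ≡-Reasoning

ℚ-ring : AlmostCommutativeRing 0ℓ 0ℓ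
ℚ-ring = fromCommutativeRing +-*-commutativeRing (λ x → dec⇒maybe (0ℚ ≟ x))

/-≃ᵘ : ∀ i n .{{_ : ℕ.NonZero n}} → toℚᵘ (i / n) ℚᵘ.≃ ℚᵘ.mkℚᵘ i (ℕ.pred n)
/-≃ᵘ i (suc n) = toℚᵘ-fromℚᵘ (ℚᵘ.mkℚᵘ i n)

≡-via-ℚᵘ : ∀ {p q i j} n → toℚᵘ p ℚᵘ.≃ ℚᵘ.mkℚᵘ i n → i ≡ j → toℚᵘ q ℚᵘ.≃ ℚᵘ.mkℚᵘ j n → p ≡ q
≡-via-ℚᵘ n p≃ refl q≃ = toℚᵘ-injective (ℚᵘP.≃-trans p≃ (ℚᵘP.≃-sym q≃))

ℕ/-≡ : ∀ a b c d .{{_ : ℕ.NonZero b}} .{{_ : ℕ.NonZero d}} →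
  a ℕ.* d ≡ c ℕ.* b → + a / b ≡ + c / d
ℕ/-≡ a b@(suc _) c d@(suc _) ad≡cb = toℚᵘ-injective
  (ℚᵘP.≃-trans (/-≃ᵘ (+ a) b) (ℚᵘP.≃-trans (ℚᵘ.*≡* cross) (ℚᵘP.≃-sym (/-≃ᵘ (+ c) d))))
  where
  cross : + a ℤ.* + d ≡ + c ℤ.* + b
  cross = trans (sym (ℤP.pos-* a d)) (trans (cong +_ ad≡cb) (ℤP.pos-* c b))

ℕ/-* : ∀ a b c d .{{_ : ℕ.NonZero b}} .{{_ : ℕ.NonZero d}} →
  (+ a / b) * (+ c / d) ≡ (+ (a ℕ.* c) / (b ℕ.* d)) {{ℕP.m*n≢0 b d}}
ℕ/-* a b@(suc _) c d@(suc _) = ≡-via-ℚᵘ _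
  (ℚᵘP.≃-trans (toℚᵘ-homo-* (+ a / b) (+ c / d)) (ℚᵘP.*-cong (/-≃ᵘ (+ a) b) (/-≃ᵘ (+ c) d)))
  (sym (ℤP.pos-* a c))
  (/-≃ᵘ (+ (a ℕ.* c)) (b ℕ.* d))

ℕ/-+ : ∀ a b c d .{{_ : ℕ.NonZero b}} .{{_ : ℕ.NonZero d}} →
  (+ a / b) + (+ c / d) ≡ (+ (a ℕ.* d ℕ.+ c ℕ.* b) / (b ℕ.* d)) {{ℕP.m*n≢0 b d}}
ℕ/-+ a b@(suc _) c d@(suc _) = ≡-via-ℚᵘ _
  (ℚᵘP.≃-trans (toℚᵘ-homo-+ (+ a / b) (+ c / d)) (ℚᵘP.+-cong (/-≃ᵘ (+ a) b) (/-≃ᵘ (+ c) d)))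
  (trans (cong₂ ℤ._+_ (sym (ℤP.pos-* a d)) (sym (ℤP.pos-* c b))) (sym (ℤP.pos-+ (a ℕ.* d) (c ℕ.* b))))
  (/-≃ᵘ (+ (a ℕ.* d ℕ.+ c ℕ.* b)) (b ℕ.* d))

ι : ℕ → ℚ
ι a = + a / 1

ι-+ : ∀ a b → ι (a ℕ.+ b) ≡ ι a + ι b
ι-+ a b = sym (trans (ℕ/-+ a 1 b 1) (ℕ/-≡ (a ℕ.* 1 ℕ.+ b ℕ.* 1) (1 ℕ.* 1) (a ℕ.+ b) 1 (cross a b)))
  where
  cross : ∀ a b → (a ℕ.* 1 ℕ.+ b ℕ.* 1) ℕ.* 1 ≡ (a ℕ.+ b) ℕ.* (1 ℕ.* 1)
  cross = ℕ-Ring.solve-∀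

ι-* : ∀ a b → ι (a ℕ.* b) ≡ ι a * ι b
ι-* a b = sym (trans (ℕ/-* a 1 b 1) (ℕ/-≡ (a ℕ.* b) (1 ℕ.* 1) (a ℕ.* b) 1 (cross a b)))
  where
  cross : ∀ a b → a ℕ.* b ℕ.* 1 ≡ a ℕ.* b ℕ.* (1 ℕ.* 1)
  cross = ℕ-Ring.solve-∀

ι-inv : ∀ m → ι (suc m) * inv-pow m 1 ≡ 1ℚ
ι-inv m = trans (ℕ/-* (suc m) 1 1 (suc m ℕ.^ 1)) (ℕ/-≡ (suc m ℕ.* 1) (1 ℕ.* (suc m ℕ.^ 1)) 1 1 (cross (suc m)))
  where
  cross : ∀ x → x ℕ.* 1 ℕ.* 1 ≡ 1 ℕ.* (1 ℕ.* (x ℕ.* 1))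
  cross = ℕ-Ring.solve-∀

inv-pow-suc : ∀ m k → inv-pow m (suc k) ≡ inv-pow m 1 * inv-pow m k
inv-pow-suc m k = sym (trans
  (ℕ/-* 1 (x ℕ.^ 1) 1 (x ℕ.^ k) {{_}} {{ℕP.m^n≢0 x k}})
  (ℕ/-≡ _ _ 1 _ {{ℕP.m*n≢0 (x ℕ.^ 1) (x ℕ.^ k) {{_}} {{ℕP.m^n≢0 x k}}}} {{ℕP.m^n≢0 x (suc k)}}
    (cross x (x ℕ.^ k))))
  where
  x : ℕ
  x = suc m
  cross : ∀ x y → 1 ℕ.* 1 ℕ.* (x ℕ.* y) ≡ 1 ℕ.* (x ℕ.* 1 ℕ.* y)
  cross = ℕ-Ring.solve-∀

ι-cancel : ∀ m q → inv-pow m 1 * (ι (suc m) * q) ≡ q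
ι-cancel m q = begin
  inv-pow m 1 * (ι (suc m) * q)   ≡⟨ sym (*-assoc (inv-pow m 1) (ι (suc m)) q) ⟩
  inv-pow m 1 * ι (suc m) * q     ≡⟨ cong (_* q) (trans (*-comm (inv-pow m 1) (ι (suc m))) (ι-inv m)) ⟩
  1ℚ * q                          ≡⟨ *-identityˡ q ⟩
  q                               ∎

ι-inv-pow : ∀ m k → ι (suc m) * inv-pow m (suc k) ≡ inv-pow m k
ι-inv-pow m k = begin
  ι (suc m) * inv-pow m (suc k)             ≡⟨ cong (ι (suc m) *_) (inv-pow-suc m k) ⟩
  ι (suc m) * (inv-pow m 1 * inv-pow m k)   ≡⟨ swap (ι (suc m)) (inv-pow m 1) (inv-pow m k) ⟩
  inv-pow m 1 * (ι (suc m) * inv-pow m k)   ≡⟨ ι-cancel m (inv-pow m k) ⟩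
  inv-pow m k                               ∎
  where
  swap : ∀ x y z → x * (y * z) ≡ y * (x * z)
  swap = solve-∀ ℚ-ring

absorption : ∀ n k → suc k ℕ.* (suc n C suc k) ≡ suc n ℕ.* (n C k)
absorption zero    zero    = refl
absorption zero    (suc k) = ℕP.*-zeroʳ (suc (suc k))
absorption (suc n) zero    =
  trans (ℕP.+-identityʳ _) (trans (nC1≡n (suc (suc n))) (sym (ℕP.*-identityʳ (suc (suc n)))))
absorption (suc n) (suc k) = begin
  suc (suc k) ℕ.* (suc (suc n) C suc (suc k))    ≡⟨ cong (suc (suc k) ℕ.*_) (sym (pascal (suc n) (suc k))) ⟩
  suc (suc k) ℕ.* (X ℕ.+ Y)                      ≡⟨ split k X Y ⟩
  suc k ℕ.* X ℕ.+ X ℕ.+ suc (suc k) ℕ.* Y        ≡⟨ cong₂ (λ u v → u ℕ.+ X ℕ.+ v) (absorption n k) (absorption n (suc k)) ⟩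
  suc n ℕ.* (n C k) ℕ.+ X ℕ.+ suc n ℕ.* (n C suc k) ≡⟨ merge n (n C k) (n C suc k) X ⟩
  suc n ℕ.* (n C k ℕ.+ n C suc k) ℕ.+ X          ≡⟨ cong (λ u → suc n ℕ.* u ℕ.+ X) (pascal n k) ⟩
  suc n ℕ.* X ℕ.+ X                              ≡⟨ ℕP.+-comm (suc n ℕ.* X) X ⟩
  suc (suc n) ℕ.* X                              ∎
  where
  pascal : ∀ n k → n C k ℕ.+ n C suc k ≡ suc n C suc k
  pascal = nCk+nC[k+1]≡[n+1]C[k+1]
  X Y : ℕ
  X = suc n C suc k
  Y = suc n C suc (suc k)
  split : ∀ k X Y → (2 ℕ.+ k) ℕ.* (X ℕ.+ Y) ≡ (1 ℕ.+ k) ℕ.* X ℕ.+ X ℕ.+ (2 ℕ.+ k) ℕ.* Y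
  split = ℕ-Ring.solve-∀
  merge : ∀ n a b X → (1 ℕ.+ n) ℕ.* a ℕ.+ X ℕ.+ (1 ℕ.+ n) ℕ.* b ≡ (1 ℕ.+ n) ℕ.* (a ℕ.+ b) ℕ.+ X
  merge = ℕ-Ring.solve-∀

pascalℚ : ∀ n k → ι (suc n C suc k) ≡ ι (n C k) + ι (n C suc k)
pascalℚ n k = trans (cong ι (sym (nCk+nC[k+1]≡[n+1]C[k+1] n k))) (ι-+ (n C k) (n C suc k))

absorptionℚ : ∀ n k → ι (suc k) * ι (suc n C suc k) ≡ ι (suc n) * ι (n C k)
absorptionℚ n k = trans (sym (ι-* (suc k) (suc n C suc k))) (trans (cong ι (absorption n k)) (ι-* (suc n) (n C k)))

sum1-cong : ∀ n {f g : ℕ → ℚ} → (∀ m → f (suc m) ≡ g (suc m)) → sum1 n f ≡ sum1 n g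
sum1-cong zero    eq = refl
sum1-cong (suc n) eq = cong₂ _+_ (sum1-cong n eq) (eq n)

sum1-+ : ∀ n (f g : ℕ → ℚ) → sum1 n (λ j → f j + g j) ≡ sum1 n f + sum1 n g
sum1-+ zero    f g = refl
sum1-+ (suc n) f g =
  trans (cong (_+ (f (suc n) + g (suc n))) (sum1-+ n f g))
        (interchange (sum1 n f) (sum1 n g) (f (suc n)) (g (suc n)))
  where
  interchange : ∀ a b c d → (a + b) + (c + d) ≡ (a + c) + (b + d)
  interchange = solve-∀ ℚ-ring

sum1-scale : ∀ n c (f : ℕ → ℚ) → sum1 n (λ j → c * f j) ≡ c * sum1 n f
sum1-scale zero    c f = sym (*-zeroʳ c)
sum1-scale (suc n) c f =
  trans (cong (_+ (c * f (suc n))) (sum1-scale n c f)) (sym (*-distribˡ-+ c (sum1 n f) (f (suc n))))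

sum1-neg : ∀ n (f : ℕ → ℚ) → sum1 n (λ j → - f j) ≡ - sum1 n f
sum1-neg zero    f = refl
sum1-neg (suc n) f =
  trans (cong (_+ (- f (suc n))) (sum1-neg n f)) (sym (neg-distrib-+ (sum1 n f) (f (suc n))))

sum1-first : ∀ n (f : ℕ → ℚ) → sum1 (suc n) f ≡ f 1 + sum1 n (λ j → f (suc j))
sum1-first zero    f = +-comm 0ℚ (f 1)
sum1-first (suc n) f =
  trans (cong (_+ f (suc (suc n))) (sum1-first n f)) (+-assoc (f 1) _ (f (suc (suc n))))

𝔅 : ℕ → (ℕ → ℚ) → ℚ
𝔅 n a = sum1 n (λ j → ι (n C j) * sign (j ∸ 1) * a j)

𝔅′ : ℕ → (ℕ → ℚ) → ℚ
𝔅′ n a = sum1 (suc n) (λ j → ι (n C (j ∸ 1)) * sign (j ∸ 1) * a j)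

𝔅-cong : ∀ n {a b : ℕ → ℚ} → (∀ m → a (suc m) ≡ b (suc m)) → 𝔅 n a ≡ 𝔅 n b
𝔅-cong n eq = sum1-cong n (λ m → cong (ι (n C suc m) * sign m *_) (eq m))

𝔅-+ : ∀ n (a b : ℕ → ℚ) → 𝔅 n (λ j → a j + b j) ≡ 𝔅 n a + 𝔅 n b
𝔅-+ n a b = trans (sum1-cong n (λ m → *-distribˡ-+ (ι (n C suc m) * sign m) (a (suc m)) (b (suc m))))
                  (sum1-+ n _ _)

-- Pascal's rule: 𝔅 (n+1) a = 𝔅 n a + 𝔅′ n a.  The extra term C(n,n+1) of
-- the sum Σ_{j=1}^{n+1} C(n,j) … vanishes.
𝔅-pascal : ∀ n a → 𝔅 (suc n) a ≡ 𝔅 n a + 𝔅′ n a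
𝔅-pascal n a = begin
  𝔅 (suc n) a                                   ≡⟨ sum1-cong (suc n) split ⟩
  sum1 (suc n) (λ j → lower j + upper j)        ≡⟨ sum1-+ (suc n) lower upper ⟩
  𝔅′ n a + (sum1 n upper + upper (suc n))       ≡⟨ cong (λ c → 𝔅′ n a + (sum1 n upper + ι c * sign n * a (suc n))) top ⟩
  𝔅′ n a + (sum1 n upper + 0ℚ * sign n * a (suc n)) ≡⟨ drop-zero (𝔅′ n a) (𝔅 n a) (sign n) (a (suc n)) ⟩
  𝔅 n a + 𝔅′ n a                                ∎
  where
  lower upper : ℕ → ℚ
  lower j = ι (n C (j ∸ 1)) * sign (j ∸ 1) * a j
  upper j = ι (n C j) * sign (j ∸ 1) * a j
  top : n C suc n ≡ 0
  top = k>n⇒nCk≡0 (ℕP.n<1+n n)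
  split : ∀ m → ι (suc n C suc m) * sign m * a (suc m) ≡ lower (suc m) + upper (suc m)
  split m = trans (cong (λ c → c * sign m * a (suc m)) (pascalℚ n m))
                  (distrib (ι (n C m)) (ι (n C suc m)) (sign m) (a (suc m)))
    where
    distrib : ∀ x y s z → (x + y) * s * z ≡ x * s * z + y * s * z
    distrib = solve-∀ ℚ-ring
  drop-zero : ∀ u t s z → u + (t + 0ℚ * s * z) ≡ t + u
  drop-zero = solve-∀ ℚ-ring

𝔅′-shift : ∀ n a → 𝔅′ n a ≡ a 1 - 𝔅 n (λ j → a (suc j))
𝔅′-shift n a = begin
  𝔅′ n a                                                      ≡⟨ sum1-first n _ ⟩
  1ℚ * 1ℚ * a 1 + sum1 n (λ j → ι (n C j) * sign j * a (suc j)) ≡⟨ cong₂ _+_ (unit (a 1)) (sum1-cong n flip) ⟩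
  a 1 + sum1 n (λ j → - (ι (n C j) * sign (j ∸ 1) * a (suc j))) ≡⟨ cong (λ t → a 1 + t) (sum1-neg n _) ⟩
  a 1 - 𝔅 n (λ j → a (suc j))                                 ∎
  where
  unit : ∀ x → 1ℚ * 1ℚ * x ≡ x
  unit = solve-∀ ℚ-ring
  negate : ∀ c s x → c * (- s) * x ≡ - (c * s * x)
  negate = solve-∀ ℚ-ring
  flip : ∀ m → ι (n C suc m) * sign (suc m) * a (suc (suc m)) ≡ - (ι (n C suc m) * sign m * a (suc (suc m)))
  flip m = negate (ι (n C suc m)) (sign m) (a (suc (suc m)))

𝔅′-absorb : ∀ n a → 𝔅′ n a ≡ inv-pow n 1 * 𝔅 (suc n) (λ j → ι j * a j)
𝔅′-absorb n a = trans (sum1-cong (suc n) term) (sum1-scale (suc n) (inv-pow n 1) _)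
  where
  term : ∀ m → ι (n C m) * sign m * a (suc m)
             ≡ inv-pow n 1 * (ι (suc n C suc m) * sign m * (ι (suc m) * a (suc m)))
  term m = sym (begin
    inv-pow n 1 * (c′ * s * (ι (suc m) * x))     ≡⟨ cong (inv-pow n 1 *_) (regroup c′ s (ι (suc m)) x) ⟩
    inv-pow n 1 * (ι (suc m) * c′ * (s * x))     ≡⟨ cong (λ y → inv-pow n 1 * (y * (s * x))) (absorptionℚ n m) ⟩
    inv-pow n 1 * (ι (suc n) * c * (s * x))      ≡⟨ cong (inv-pow n 1 *_) (*-assoc (ι (suc n)) c (s * x)) ⟩
    inv-pow n 1 * (ι (suc n) * (c * (s * x)))    ≡⟨ ι-cancel n (c * (s * x)) ⟩
    c * (s * x)                                  ≡⟨ sym (*-assoc c s x) ⟩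
    c * s * x                                    ∎)
    where
    c′ c s x : ℚ
    c′ = ι (suc n C suc m)
    c  = ι (n C m)
    s  = sign m
    x  = a (suc m)
    regroup : ∀ c′ s i x → c′ * s * (i * x) ≡ i * c′ * (s * x)
    regroup = solve-∀ ℚ-ring

𝔅-suc : ∀ m a → 𝔅 (suc m) a ≡ 𝔅 m a + (a 1 - 𝔅 m (λ j → a (suc j)))
𝔅-suc m a = trans (𝔅-pascal m a) (cong (λ t → 𝔅 m a + t) (𝔅′-shift m a))

𝔅-const : ∀ m c → 𝔅 (suc m) (λ _ → c) ≡ c
𝔅-const m c = trans (𝔅-suc m (λ _ → c)) (cancel (𝔅 m (λ _ → c)) c)
  where
  cancel : ∀ t c → t + (c - t) ≡ c
  cancel = solve-∀ ℚ-ring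

Δ : (ℕ → ℚ) → ℕ → ℚ
Δ y j = y j - y (j ∸ 1)

-- Write y = b + Δ y with b_j = y_{j-1}; then b ∘ suc = y and b_1 = y_0, so
-- 𝔅-suc applied to b expresses 𝔅 (m+1) b through 𝔅 m b and 𝔅 m y.
𝔅-parts : ∀ m y → 𝔅 (suc m) y ≡ y 0 + (𝔅 (suc m) (Δ y) - 𝔅 m (Δ y))
𝔅-parts m y = begin
  𝔅 (suc m) y                                          ≡⟨ decompose (suc m) ⟩
  𝔅 (suc m) b + 𝔅 (suc m) (Δ y)                        ≡⟨ cong (_+ 𝔅 (suc m) (Δ y)) (𝔅-suc m b) ⟩
  𝔅 m b + (y 0 - 𝔅 m y) + 𝔅 (suc m) (Δ y)              ≡⟨ cong (λ t → 𝔅 m b + (y 0 - t) + 𝔅 (suc m) (Δ y)) (decompose m) ⟩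
  𝔅 m b + (y 0 - (𝔅 m b + 𝔅 m (Δ y))) + 𝔅 (suc m) (Δ y) ≡⟨ rearrange (𝔅 m b) (y 0) (𝔅 m (Δ y)) (𝔅 (suc m) (Δ y)) ⟩
  y 0 + (𝔅 (suc m) (Δ y) - 𝔅 m (Δ y))                  ∎
  where
  b : ℕ → ℚ
  b j = y (j ∸ 1)
  split : ∀ u v → u ≡ v + (u - v)
  split = solve-∀ ℚ-ring
  decompose : ∀ n → 𝔅 n y ≡ 𝔅 n b + 𝔅 n (Δ y)
  decompose n = trans (𝔅-cong n (λ i → split (y (suc i)) (y i))) (𝔅-+ n b (Δ y))
  rearrange : ∀ t y₀ d d′ → t + (y₀ - (t + d)) + d′ ≡ y₀ + (d′ - d)
  rearrange = solve-∀ ℚ-ring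

-- a/j^k : j ↦ a_j / j^k  (the value at j = 0 is never used).
_/j^_ : (ℕ → ℚ) → ℕ → ℕ → ℚ
(a /j^ k) zero    = 0ℚ
(a /j^ k) (suc m) = inv-pow m k * a (suc m)

-- 𝔅 (n+1) (a/j^{k+1}) = 𝔅 n (a/j^{k+1}) + 1/(n+1) · 𝔅 (n+1) (a/j^k):
-- Pascal's rule followed by absorption, which trades one factor 1/j for 1/(n+1).
𝔅-/j^-suc : ∀ n k a → 𝔅 (suc n) (a /j^ suc k) ≡ 𝔅 n (a /j^ suc k) + inv-pow n 1 * 𝔅 (suc n) (a /j^ k)
𝔅-/j^-suc n k a = begin
  𝔅 (suc n) (a /j^ suc k)                                            ≡⟨ 𝔅-pascal n _ ⟩
  𝔅 n (a /j^ suc k) + 𝔅′ n (a /j^ suc k)                              ≡⟨ cong (λ t → 𝔅 n (a /j^ suc k) + t) (𝔅′-absorb n _) ⟩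
  𝔅 n (a /j^ suc k) + inv-pow n 1 * 𝔅 (suc n) (λ j → ι j * (a /j^ suc k) j) ≡⟨ cong (λ t → 𝔅 n (a /j^ suc k) + inv-pow n 1 * t) (𝔅-cong (suc n) lower) ⟩
  𝔅 n (a /j^ suc k) + inv-pow n 1 * 𝔅 (suc n) (a /j^ k)               ∎
  where
  lower : ∀ m → ι (suc m) * (inv-pow m (suc k) * a (suc m)) ≡ inv-pow m k * a (suc m)
  lower m = trans (sym (*-assoc (ι (suc m)) _ (a (suc m)))) (cong (_* a (suc m)) (ι-inv-pow m k))

𝔅-ζ★ : ∀ k a i s →
  (∀ m → inv-pow m 1 * 𝔅 (suc m) (a /j^ k) ≡ inv-pow m i * zetaStar (suc m) s) →
  ∀ n → 𝔅 n (a /j^ suc k) ≡ zetaStar n (i ∷ s)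
𝔅-ζ★ k a i s increment zero    = refl
𝔅-ζ★ k a i s increment (suc n) = begin
  𝔅 (suc n) (a /j^ suc k)                                 ≡⟨ 𝔅-/j^-suc n k a ⟩
  𝔅 n (a /j^ suc k) + inv-pow n 1 * 𝔅 (suc n) (a /j^ k)   ≡⟨ cong₂ _+_ (𝔅-ζ★ k a i s increment n) (increment n) ⟩
  zetaStar (suc n) (i ∷ s)                                ∎

ζ★1s : ℕ → ℕ → ℚ
ζ★1s ℓ j = zetaStar j (ones ℓ)

lhs≡𝔅 : ∀ n k ℓ → lhs n k ℓ ≡ 𝔅 n (ζ★1s ℓ /j^ k)
lhs≡𝔅 n k ℓ = sum1-cong n (λ m → *-assoc (ι (n C suc m) * sign m) (inv-pow m k) (ζ★1s ℓ (suc m)))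

k≡0-case : ∀ ℓ m → 𝔅 (suc m) (ζ★1s ℓ /j^ 0) ≡ inv-pow m ℓ
depth-one : ∀ ℓ n → 𝔅 n (ζ★1s ℓ /j^ 1) ≡ zetaStar n (suc ℓ ∷ [])

k≡0-case zero     m = trans (𝔅-cong (suc m) (λ _ → *-identityˡ 1ℚ)) (𝔅-const m 1ℚ)
k≡0-case (suc ℓ) m = begin
  𝔅 (suc m) (y /j^ 0)                                             ≡⟨ 𝔅-cong (suc m) (λ i → *-identityˡ (y (suc i))) ⟩
  𝔅 (suc m) y                                                     ≡⟨ 𝔅-parts m y ⟩
  0ℚ + (𝔅 (suc m) (Δ y) - 𝔅 m (Δ y))                               ≡⟨ cong₂ (λ p q → 0ℚ + (p - q)) (Δy-transform (suc m)) (Δy-transform m) ⟩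
  0ℚ + (zetaStar (suc m) (suc ℓ ∷ []) - zetaStar m (suc ℓ ∷ []))    ≡⟨ last-term (zetaStar m (suc ℓ ∷ [])) (inv-pow m (suc ℓ)) ⟩
  inv-pow m (suc ℓ)                                               ∎
  where
  y : ℕ → ℚ
  y = ζ★1s (suc ℓ)
  increment : ∀ u v → u + v - u ≡ v
  increment = solve-∀ ℚ-ring
  -- Δ ζ★_j({1}_{ℓ+1}) = ζ★_j({1}_ℓ) / j, whose transform is the depth-one value.
  Δy-transform : ∀ n → 𝔅 n (Δ y) ≡ zetaStar n (suc ℓ ∷ [])
  Δy-transform n = trans (𝔅-cong n (λ i → increment (y i) (inv-pow i 1 * ζ★1s ℓ (suc i)))) (depth-one ℓ n)
  last-term : ∀ z i → 0ℚ + (z + i * 1ℚ - z) ≡ i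
  last-term = solve-∀ ℚ-ring

depth-one ℓ = 𝔅-ζ★ 0 (ζ★1s ℓ) (suc ℓ) [] increment
  where
  increment : ∀ m → inv-pow m 1 * 𝔅 (suc m) (ζ★1s ℓ /j^ 0) ≡ inv-pow m (suc ℓ) * 1ℚ
  increment m = begin
    inv-pow m 1 * 𝔅 (suc m) (ζ★1s ℓ /j^ 0)   ≡⟨ cong (inv-pow m 1 *_) (k≡0-case ℓ m) ⟩
    inv-pow m 1 * inv-pow m ℓ                ≡⟨ sym (inv-pow-suc m ℓ) ⟩
    inv-pow m (suc ℓ)                        ≡⟨ sym (*-identityʳ _) ⟩
    inv-pow m (suc ℓ) * 1ℚ                   ∎

-- Case k ≥ 1, by induction on k: each extra factor 1/j prepends a 1 to the index.
k≥1-case : ∀ ℓ k n → 𝔅 n (ζ★1s ℓ /j^ suc k) ≡ zetaStar n (ones k ++ (suc ℓ ∷ []))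
k≥1-case ℓ zero    = depth-one ℓ
k≥1-case ℓ (suc k) = 𝔅-ζ★ (suc k) (ζ★1s ℓ) 1 (ones k ++ (suc ℓ ∷ []))
  (λ m → cong (inv-pow m 1 *_) (k≥1-case ℓ k (suc m)))

lemma5 : (n k ℓ : ℕ) → n ≥ 1 →
    (k ≥ 1 → lhs n k ℓ ≡ zetaStar n (ones (k ∸ 1) ++ (suc ℓ ∷ [])))
    × (k ≡ 0 → lhs n k ℓ ≡ inv-pow (n ∸ 1) ℓ)
lemma5 (suc m) k ℓ _ = positive , vanishing
  where
  positive : k ≥ 1 → lhs (suc m) k ℓ ≡ zetaStar (suc m) (ones (k ∸ 1) ++ (suc ℓ ∷ []))
  positive (ℕ.s≤s {n = k′} _) = trans (lhs≡𝔅 (suc m) (suc k′) ℓ) (k≥1-case ℓ k′ (suc m))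
  vanishing : k ≡ 0 → lhs (suc m) k ℓ ≡ inv-pow m ℓ
  vanishing refl = trans (lhs≡𝔅 (suc m) 0 ℓ) (k≡0-case ℓ m)
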